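{- Let $P$ be a $\Sigma$-pattern with first symbol in $\Sigma$, of length $r$ and with exactly one gap (i.e. $\mathrm{T}(P)$ is a Toeplitz word of type $(r,1)$). Then for all positive integers $a,b$, the arithmetic subsequence $\mathrm{T}(P)_{a,b}$ is a Toeplitz word, i.e. there is a $\Sigma$-pattern $Q$ with first symbol in $\Sigma$ such that $\mathrm{T}(P)_{a,b}=\mathrm{T}(Q)$.
   Context: $\Sigma$ is a fixed finite cyclic group, $\mathrm{S}_\Sigma$ the group of bijections of $\Sigma$ (assumed disjoint from $\Sigma$), whose elements are called gaps. A $\Sigma$-pattern is a nonempty finite word over $\Sigma\cup\mathrm{S}_\Sigma$. For words $x,y$ over $\Sigma\cup\mathrm{S}_\Sigma$, $x\langle y\rangle$ fills the gaps of $x$ in order by the letters of $y$: $(a\,x)\langle y\rangle=a\,x\langle y\rangle$, $(f\,x)\langle b\,y\rangle=f(b)\,x\langle y\rangle$, $(f\,x)\langle g\,y\rangle=(f\circ g)\,x\langle y\rangle$ ($a,b\in\Sigma$, $f,g\in\mathrm{S}_\Sigma$). For a pattern $P$ whose first symbol is in $\Sigma$, let $T_0=?^\omega$ ($?$ the identity bijection), $T_{i+1}=P^\omega\langle T_i\rangle$; the Toeplitz word generated by $P$ is $\mathrm{T}(P)=\lim_i T_i$, an infinite word over $\Sigma$ indexed by positive integers. For a sequence $\sigma$ indexed by positive integers and $a,b\ge1$, $\sigma_{a,b}(n)=\sigma(a+b(n-1))$ for $n\ge1$. -}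

module Defs where

open import Data.Nat using (ℕ; zero; suc; _+_; _*_; _∸_; _≤_; _%_)
open import Data.Fin using (Fin)
open import Data.Fin.Permutation using (Permutation′; _⟨$⟩ʳ_; _∘ₚ_; id)
open import Data.List using (List; []; _∷_; length)
open import Data.Sum using (_⊎_; inj₁; inj₂)
open import Data.Product using (∃)
open import Data.Empty using (⊥)
open import Data.Unit using (⊤)
open import Relation.Binary.PropositionalEquality using (_≡_)

-- The alphabet Σ: a finite cyclic group of order suc k, whose underlying set is Fin (suc k).
-- (Its group structure plays no role in the statement.)
Alph : ℕ → Set
Alph k = Fin (suc k)

Gap : ℕ → Set
Gap k = Permutation′ (suc k)

Sym : ℕ → Set
Sym k = Alph k ⊎ Gap k

idGap : ∀ {k} → Gap k
idGap = id

-- f ∘ g (apply g first).  Note: π₁ ∘ₚ π₂ applies π₁ first.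
_∘g_ : ∀ {k} → Gap k → Gap k → Gap k
f ∘g g = g ∘ₚ f

-- Infinite words, 0-indexed internally (internal index n = paper position n+1).
Word : Set → Set
Word A = ℕ → A

tailW : ∀ {A : Set} → Word A → Word A
tailW x n = x (suc n)

fill : ∀ {k} → Word (Sym k) → Word (Sym k) → Word (Sym k)
fill x y zero with x zero
... | inj₁ a = inj₁ a
... | inj₂ f with y zero
...   | inj₁ b = inj₁ (f ⟨$⟩ʳ b)
...   | inj₂ g = inj₂ (f ∘g g)
fill x y (suc n) with x zero
... | inj₁ a = fill (tailW x) y n
... | inj₂ f = fill (tailW x) (tailW y) n

at : ∀ {A : Set} → A → List A → ℕ → A
at d [] n = d
at d (x ∷ xs) zero = x
at d (x ∷ xs) (suc n) = at d xs n

-- P^ω (for the empty list, which is not a pattern, this is a dummy constant word).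
omega : ∀ {k} → List (Sym k) → Word (Sym k)
omega [] n = inj₂ idGap
omega (x ∷ xs) n = at x (x ∷ xs) (n % length (x ∷ xs))

StartsWithLetter : ∀ {k} → List (Sym k) → Set
StartsWithLetter [] = ⊥
StartsWithLetter (inj₁ a ∷ xs) = ⊤
StartsWithLetter (inj₂ f ∷ xs) = ⊥

gapCount : ∀ {k} → List (Sym k) → ℕ
gapCount [] = zero
gapCount (inj₁ a ∷ xs) = gapCount xs
gapCount (inj₂ f ∷ xs) = suc (gapCount xs)

approx : ∀ {k} → List (Sym k) → ℕ → Word (Sym k)
approx P zero = λ _ → inj₂ idGap
approx P (suc i) = fill (omega P) (approx P i)

-- w is the Toeplitz word T(P) = lim_i T_i (pointwise eventual constancy, value in Σ).
IsToeplitzOf : ∀ {k} → List (Sym k) → Word (Alph k) → Set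
IsToeplitzOf P w = ∀ n → ∃ λ i → ∀ m → i ≤ m → approx P m n ≡ inj₁ (w n)

-- σ_{a,b}(n) = σ(a + b(n-1)), paper positions n ≥ 1; in 0-indexed form
-- the internal index m (= n-1) maps to internal index (a-1) + b*m.
arith : ∀ {A : Set} → Word A → ℕ → ℕ → Word A
arith w a b m = w ((a ∸ 1) + b * m)

module Submission where

-- Let w = T(P) with |P| = r and a single gap f at position j.  Then w (q r + s) = w s for s ≠ j
-- and w (q r + j) = f (w q); iterating, in blocks of length r^N every position except
-- J N = j (r^N - 1)/(r - 1) repeats the first block, and w (n r^N + J N) = f^N (w n).
-- For u t = w (c + b t) there are two cases.  If for some suitable depth N₀ no term of the
-- progression c + b ℕ lies in the class J N₀ modulo r^N₀, then u has period r^N₀.  Otherwise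
-- elementary number theory (eventual periodicity of r^N modulo b) yields depths D < M and an
-- offset G = ρ + e r^D such that u (G + r^D n) = f^D (u n), while the other positions of u repeat
-- with period r^(M+D), and a few initial ones with period r^M.  Such a self-similar word is T(Q)
-- for an explicit pattern Q of length r^(M+D).

open import Defs
open import Data.Nat using (ℕ; zero; suc; _+_; _*_; _∸_; _^_; _≤_; _<_; _%_; _/_; s≤s; z≤n; NonZero; >-nonZero; >-nonZero⁻¹; _≟_; _<?_; _≤?_)
open import Data.Nat.Properties
open import Data.Nat.DivMod using (m%n<n; m<n⇒m%n≡m; [m+n]%n≡m%n; [m+kn]%n≡m%n; m≡m%n+[m/n]*n; m<n*o⇒m/o<n; m*n%n≡0; %-distribˡ-+; %-distribˡ-*)
open import Data.Nat.Divisibility using (_∣_; divides; m%n≡0⇒n∣m; n∣m⇒m%n≡0; ∣n⇒∣m*n; ∣m∣n⇒∣m+n; ∣m+n∣m⇒∣n; m∣m*n)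
open import Data.Nat.Induction using (<-wellFounded)
open import Data.Nat.Tactic.RingSolver using (solve-∀)
open import Induction.WellFounded using (Acc; acc)
open import Data.Fin using (Fin; toℕ; fromℕ<) renaming (_≟_ to _≟ᶠ_)
open import Data.Fin.Properties using (pigeonhole; toℕ-fromℕ<; any?)
open import Data.Fin.Permutation using (_⟨$⟩ʳ_; id; transpose)
open import Data.List using (List; []; _∷_; length; applyUpTo)
open import Data.List.Properties using (length-applyUpTo)
open import Data.Sum using (_⊎_; inj₁; inj₂)
open import Data.Product using (∃; Σ; _×_; _,_)
open import Data.Empty using (⊥-elim)
open import Data.Unit using (tt)
open import Relation.Nullary using (¬_; Dec; yes; no)
open import Relation.Binary.PropositionalEquality using (_≡_; _≢_; refl; sym; trans; cong; cong₂; subst; subst₂; module ≡-Reasoning)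

combine : ∀ {k} → Sym k → Sym k → Sym k
combine (inj₁ a) y = inj₁ a
combine (inj₂ f) (inj₁ b) = inj₁ (f ⟨$⟩ʳ b)
combine (inj₂ f) (inj₂ g) = inj₂ (f ∘g g)

isGap : ∀ {k} → Sym k → ℕ
isGap (inj₁ _) = 0
isGap (inj₂ _) = 1

gapsBefore : ∀ {k} → Word (Sym k) → ℕ → ℕ
gapsBefore x zero = 0
gapsBefore x (suc n) = isGap (x 0) + gapsBefore (tailW x) n

fill-pointwise : ∀ {k} (x y : Word (Sym k)) n → fill x y n ≡ combine (x n) (y (gapsBefore x n))
fill-pointwise x y zero with x zero
... | inj₁ a = refl
... | inj₂ f with y zero
...   | inj₁ b = refl
...   | inj₂ g = refl
fill-pointwise x y (suc n) with x zero
... | inj₁ a = fill-pointwise (tailW x) y n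
... | inj₂ f = fill-pointwise (tailW x) (tailW y) n

approx-suc : ∀ {k} (Q : List (Sym k)) m n →
  approx Q (suc m) n ≡ combine (omega Q n) (approx Q m (gapsBefore (omega Q) n))
approx-suc Q m n = fill-pointwise (omega Q) (approx Q m) n

gapsBefore-+ : ∀ {k} (x : Word (Sym k)) m n →
  gapsBefore x (m + n) ≡ gapsBefore x m + gapsBefore (λ t → x (m + t)) n
gapsBefore-+ x zero n = refl
gapsBefore-+ x (suc m) n =
  trans (cong (isGap (x 0) +_) (gapsBefore-+ (tailW x) m n)) (sym (+-assoc (isGap (x 0)) _ _))

gapsBefore-ext : ∀ {k} (x y : Word (Sym k)) n → (∀ t → t < n → x t ≡ y t) →
  gapsBefore x n ≡ gapsBefore y n
gapsBefore-ext x y zero eq = refl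
gapsBefore-ext x y (suc n) eq =
  cong₂ _+_ (cong isGap (eq 0 (s≤s z≤n))) (gapsBefore-ext (tailW x) (tailW y) n (λ t lt → eq (suc t) (s≤s lt)))

gapsBefore-suc : ∀ {k} (x : Word (Sym k)) n → gapsBefore x (suc n) ≡ gapsBefore x n + isGap (x n)
gapsBefore-suc x n = begin
  gapsBefore x (suc n)                                  ≡⟨ cong (gapsBefore x) (+-comm 1 n) ⟩
  gapsBefore x (n + 1)                                  ≡⟨ gapsBefore-+ x n 1 ⟩
  gapsBefore x n + (isGap (x (n + 0)) + 0)
    ≡⟨ cong (gapsBefore x n +_) (trans (+-identityʳ _) (cong (λ m → isGap (x m)) (+-identityʳ n))) ⟩
  gapsBefore x n + isGap (x n)                          ∎
  where open ≡-Reasoning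

gapsBefore-letters : ∀ {k} (x : Word (Sym k)) n m → (∀ t → t < m → isGap (x (n + t)) ≡ 0) →
  gapsBefore x (n + m) ≡ gapsBefore x n
gapsBefore-letters x n zero h = cong (gapsBefore x) (+-identityʳ n)
gapsBefore-letters x n (suc m) h = begin
  gapsBefore x (n + suc m)              ≡⟨ cong (gapsBefore x) (+-suc n m) ⟩
  gapsBefore x (suc (n + m))            ≡⟨ gapsBefore-suc x (n + m) ⟩
  gapsBefore x (n + m) + isGap (x (n + m)) ≡⟨ cong₂ _+_ (gapsBefore-letters x n m (λ t lt → h t (m≤n⇒m≤1+n lt))) (h m ≤-refl) ⟩
  gapsBefore x n + 0                    ≡⟨ +-identityʳ _ ⟩
  gapsBefore x n                        ∎
  where open ≡-Reasoning

gapsBefore-periodic : ∀ {k} (x : Word (Sym k)) L → (∀ t → x (L + t) ≡ x t) →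
  ∀ q n → gapsBefore x (q * L + n) ≡ q * gapsBefore x L + gapsBefore x n
gapsBefore-periodic x L per zero n = refl
gapsBefore-periodic x L per (suc q) n = begin
  gapsBefore x (L + q * L + n)                               ≡⟨ cong (gapsBefore x) (+-assoc L (q * L) n) ⟩
  gapsBefore x (L + (q * L + n))                             ≡⟨ gapsBefore-+ x L (q * L + n) ⟩
  gapsBefore x L + gapsBefore (λ t → x (L + t)) (q * L + n)  ≡⟨ cong (gapsBefore x L +_) (gapsBefore-ext _ x (q * L + n) (λ t _ → per t)) ⟩
  gapsBefore x L + gapsBefore x (q * L + n)                  ≡⟨ cong (gapsBefore x L +_) (gapsBefore-periodic x L per q n) ⟩
  gapsBefore x L + (q * gapsBefore x L + gapsBefore x n)     ≡⟨ sym (+-assoc (gapsBefore x L) _ _) ⟩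
  gapsBefore x L + q * gapsBefore x L + gapsBefore x n       ∎
  where open ≡-Reasoning

omega-periodic : ∀ {k} (Q : List (Sym k)) t → omega Q (length Q + t) ≡ omega Q t
omega-periodic [] t = refl
omega-periodic (x ∷ xs) t = cong (at x (x ∷ xs)) (trans (cong (_% length (x ∷ xs)) (+-comm (length (x ∷ xs)) t)) ([m+n]%n≡m%n t (length (x ∷ xs))))

at-applyUpTo : ∀ {A : Set} (d : A) (g : ℕ → A) L s → s < L → at d (applyUpTo g L) s ≡ g s
at-applyUpTo d g (suc L) zero lt = refl
at-applyUpTo d g (suc L) (suc s) (s≤s lt) = at-applyUpTo d (λ t → g (suc t)) L s lt

omega-applyUpTo : ∀ {k} (g : ℕ → Sym k) L .{{_ : NonZero L}} n → omega (applyUpTo g L) n ≡ g (n % L)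
omega-applyUpTo g (suc L) n = begin
  at (g 0) (applyUpTo g (suc L)) (n % suc (length (applyUpTo (λ t → g (suc t)) L)))
    ≡⟨ cong (λ m → at (g 0) (applyUpTo g (suc L)) (n % suc m)) (length-applyUpTo (λ t → g (suc t)) L) ⟩
  at (g 0) (applyUpTo g (suc L)) (n % suc L)
    ≡⟨ at-applyUpTo (g 0) g (suc L) (n % suc L) (m%n<n n (suc L)) ⟩
  g (n % suc L) ∎
  where open ≡-Reasoning

LocallyGenerated : ∀ {k} → List (Sym k) → Word (Alph k) → ℕ → Set
LocallyGenerated {k} Q u n = (omega Q n ≡ inj₁ (u n)) ⊎
  Σ (Gap k) λ φ → (omega Q n ≡ inj₂ φ) × (u n ≡ φ ⟨$⟩ʳ u (gapsBefore (omega Q) n)) × (gapsBefore (omega Q) n < n)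

-- By well-founded
-- induction on n: the approximants stabilise at n one step after they stabilise at the position
-- that fills the gap at n.
toeplitz-criterion : ∀ {k} (Q : List (Sym k)) (u : Word (Alph k)) →
  (∀ n → LocallyGenerated Q u n) → IsToeplitzOf Q u
toeplitz-criterion Q u loc n = stable n (<-wellFounded n)
  where
  stable : ∀ n → Acc _<_ n → ∃ λ i → ∀ m → i ≤ m → approx Q m n ≡ inj₁ (u n)
  stable n (acc rec) with loc n
  ... | inj₁ letter = 1 , λ where
    (suc m) _ → trans (approx-suc Q m n) (cong (λ s → combine s (approx Q m (gapsBefore (omega Q) n))) letter)
  ... | inj₂ (φ , gap , eq , earlier) with stable (gapsBefore (omega Q) n) (rec earlier)
  ...   | i , h = suc i , λ where
    (suc m) (s≤s i≤m) → trans (approx-suc Q m n) (trans (cong₂ combine gap (h m i≤m)) (cong inj₁ (sym eq)))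

inj₁-injective : ∀ {A B : Set} {a b : A} → inj₁ {B = B} a ≡ inj₁ b → a ≡ b
inj₁-injective refl = refl

toeplitz-letter : ∀ {k} (P : List (Sym k)) (w : Word (Alph k)) → IsToeplitzOf P w →
  ∀ n a → omega P n ≡ inj₁ a → w n ≡ a
toeplitz-letter P w T n a letter with T n
... | i , h = inj₁-injective (begin
  inj₁ (w n)                                                   ≡⟨ sym (h (suc i) (n≤1+n i)) ⟩
  approx P (suc i) n                                           ≡⟨ approx-suc P i n ⟩
  combine (omega P n) (approx P i (gapsBefore (omega P) n))    ≡⟨ cong (λ s → combine s (approx P i (gapsBefore (omega P) n))) letter ⟩
  inj₁ a                                                       ∎)
  where open ≡-Reasoning

toeplitz-gap : ∀ {k} (P : List (Sym k)) (w : Word (Alph k)) → IsToeplitzOf P w →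
  ∀ n f → omega P n ≡ inj₂ f → w n ≡ f ⟨$⟩ʳ w (gapsBefore (omega P) n)
toeplitz-gap P w T n f gap with T n | T (gapsBefore (omega P) n)
... | i , h | i′ , h′ = inj₁-injective (begin
  inj₁ (w n)                                     ≡⟨ sym (h (suc (i + i′)) (≤-trans (m≤m+n i i′) (n≤1+n _))) ⟩
  approx P (suc (i + i′)) n                      ≡⟨ approx-suc P (i + i′) n ⟩
  combine (omega P n) (approx P (i + i′) (gapsBefore (omega P) n))
                                                 ≡⟨ cong₂ combine gap (h′ (i + i′) (m≤n+m i′ i)) ⟩
  inj₁ (f ⟨$⟩ʳ w (gapsBefore (omega P) n))       ∎)
  where open ≡-Reasoning

IsLetter : ∀ {k} → Sym k → Set
IsLetter {k} s = Σ (Alph k) λ a → s ≡ inj₁ a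

letter-isGap : ∀ {k} {s : Sym k} → IsLetter s → isGap s ≡ 0
letter-isGap (a , refl) = refl

gapsBefore-at : ∀ {k} (d : Sym k) (L : List (Sym k)) → gapsBefore (at d L) (length L) ≡ gapCount L
gapsBefore-at d [] = refl
gapsBefore-at d (inj₁ a ∷ L) = gapsBefore-at d L
gapsBefore-at d (inj₂ f ∷ L) = cong suc (gapsBefore-at d L)

noGaps⇒letters : ∀ {k} (d : Sym k) (L : List (Sym k)) → gapCount L ≡ 0 →
  ∀ s → s < length L → IsLetter (at d L s)
noGaps⇒letters d (inj₁ a ∷ L) e zero _ = a , refl
noGaps⇒letters d (inj₁ a ∷ L) e (suc s) (s≤s lt) = noGaps⇒letters d L e s lt

record SingleGap {k} (d : Sym k) (L : List (Sym k)) : Set where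
  field
    pos : ℕ
    gap : Gap k
    pos<length : pos < length L
    gapAt : at d L pos ≡ inj₂ gap
    lettersElsewhere : ∀ s → s < length L → s ≢ pos → IsLetter (at d L s)

singleGap : ∀ {k} (d : Sym k) (L : List (Sym k)) → gapCount L ≡ 1 → SingleGap d L
singleGap d (inj₁ a ∷ L) e = record
  { pos = suc pos ; gap = gap ; pos<length = s≤s pos<length ; gapAt = gapAt
  ; lettersElsewhere = λ where
      zero _ _ → a , refl
      (suc s) (s≤s lt) ne → lettersElsewhere s lt (λ eq → ne (cong suc eq)) }
  where open SingleGap (singleGap d L e)
singleGap d (inj₂ f ∷ L) e = record
  { pos = 0 ; gap = f ; pos<length = s≤s z≤n ; gapAt = refl
  ; lettersElsewhere = λ where
      zero _ ne → ⊥-elim (ne refl)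
      (suc s) (s≤s lt) _ → noGaps⇒letters d L (suc-injective e) s lt }

record OneGapToeplitz {k} (w : Word (Alph k)) : Set where
  field
    r₀ j : ℕ
    f : Gap k
    1≤j : 1 ≤ j
    j<r : j < suc r₀
    letterPos : ∀ q s → s < suc r₀ → s ≢ j → w (q * suc r₀ + s) ≡ w s
    gapPos : ∀ q → w (q * suc r₀ + j) ≡ f ⟨$⟩ʳ w q

-- The structure of T(P) for a one-gap pattern P starting with a letter (so 1 ≤ j): positions of
-- P^ω carrying a letter carry it in w, and by periodicity of P^ω the gap at q r + j is the q-th
-- gap, hence is filled from w q.
oneGapToeplitz : ∀ {k} (P : List (Sym k)) → StartsWithLetter P → gapCount P ≡ 1 →
  (w : Word (Alph k)) → IsToeplitzOf P w → OneGapToeplitz w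
oneGapToeplitz (inj₁ a ∷ xs) _ one w T with singleGap (inj₁ a) (inj₁ a ∷ xs) one
... | record { pos = zero ; gapAt = () }
... | record { pos = suc j ; gap = f ; pos<length = j<r ; gapAt = gapAt ; lettersElsewhere = letters } = record
  { r₀ = length xs ; j = suc j ; f = f ; 1≤j = s≤s z≤n ; j<r = j<r ; letterPos = letterPos ; gapPos = gapPos }
  where
  open ≡-Reasoning
  P = inj₁ a ∷ xs
  r = length P
  sym-at : ∀ q s → s < r → omega P (q * r + s) ≡ at (inj₁ a) P s
  sym-at q s lt = cong (at (inj₁ a) P) (trans (cong (_% r) (+-comm (q * r) s)) (trans ([m+kn]%n≡m%n s q r) (m<n⇒m%n≡m lt)))
  gapsBefore-gap : gapsBefore (omega P) (suc j) ≡ 0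
  gapsBefore-gap = gapsBefore-letters (omega P) 0 (suc j) λ t lt →
    letter-isGap (subst IsLetter (sym (sym-at 0 t (<-trans lt j<r))) (letters t (<-trans lt j<r) (<⇒≢ lt)))
  gapsPerPeriod : gapsBefore (omega P) r ≡ 1
  gapsPerPeriod = trans (gapsBefore-ext (omega P) (at (inj₁ a) P) r (sym-at 0)) (trans (gapsBefore-at (inj₁ a) P) one)
  letterPos : ∀ q s → s < r → s ≢ suc j → w (q * r + s) ≡ w s
  letterPos q s lt ne with letters s lt ne
  ... | b , letter = trans (toeplitz-letter P w T (q * r + s) b (trans (sym-at q s lt) letter))
                           (sym (toeplitz-letter P w T s b (trans (sym-at 0 s lt) letter)))
  gapPos : ∀ q → w (q * r + suc j) ≡ f ⟨$⟩ʳ w q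
  gapPos q = trans (toeplitz-gap P w T (q * r + suc j) f (trans (sym-at q (suc j) j<r) gapAt))
    (cong (λ z → f ⟨$⟩ʳ w z) (begin
      gapsBefore (omega P) (q * r + suc j)  ≡⟨ gapsBefore-periodic (omega P) r (omega-periodic P) q (suc j) ⟩
      q * gapsBefore (omega P) r + gapsBefore (omega P) (suc j) ≡⟨ cong₂ (λ m n → q * m + n) gapsPerPeriod gapsBefore-gap ⟩
      q * 1 + 0                              ≡⟨ trans (+-identityʳ _) (*-identityʳ q) ⟩
      q ∎))

-- depthPos r j N: the base-r numeral j j … j with N digits, i.e. j (r^N - 1)/(r - 1).  It is the
-- position, within a block of length r^N, of the gap created by N nested fillings.
depthPos : ℕ → ℕ → ℕ → ℕ
depthPos r j zero = 0
depthPos r j (suc N) = j + r * depthPos r j N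

depthPos<r^N : ∀ {r j} → j < r → ∀ N → depthPos r j N < r ^ N
depthPos<r^N j<r zero = s≤s z≤n
depthPos<r^N {r} {j} j<r (suc N) = begin-strict
  j + r * depthPos r j N   <⟨ +-monoˡ-< (r * depthPos r j N) j<r ⟩
  r + r * depthPos r j N   ≡⟨ sym (*-suc r (depthPos r j N)) ⟩
  r * suc (depthPos r j N) ≤⟨ *-monoʳ-≤ r (depthPos<r^N j<r N) ⟩
  r * r ^ N                ∎
  where open ≤-Reasoning

depthPos-+ : ∀ r j E D → depthPos r j (E + D) ≡ r ^ D * depthPos r j E + depthPos r j D
depthPos-+ r j E zero = trans (cong (depthPos r j) (+-identityʳ E)) (sym (trans (+-identityʳ _) (+-identityʳ _)))
depthPos-+ r j E (suc D) = begin
  depthPos r j (E + suc D)                          ≡⟨ cong (depthPos r j) (+-suc E D) ⟩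
  j + r * depthPos r j (E + D)                      ≡⟨ cong (λ x → j + r * x) (depthPos-+ r j E D) ⟩
  j + r * (r ^ D * depthPos r j E + depthPos r j D) ≡⟨ lemma r (r ^ D) (depthPos r j E) (depthPos r j D) j ⟩
  r * r ^ D * depthPos r j E + (j + r * depthPos r j D) ∎
  where
  open ≡-Reasoning
  lemma : ∀ r y z u j → j + r * (y * z + u) ≡ r * y * z + (j + r * u)
  lemma = solve-∀

N≤depthPos : ∀ {r₀ j} → 1 ≤ j → ∀ N → N ≤ depthPos (suc r₀) j N
N≤depthPos 1≤j zero = z≤n
N≤depthPos {r₀} {j} 1≤j (suc N) = +-mono-≤ 1≤j (≤-trans (N≤depthPos 1≤j N) (m≤n*m _ (suc r₀)))

depthPos-geometric : ∀ r₀ j D → r₀ * depthPos (suc r₀) j D + j ≡ j * suc r₀ ^ D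
depthPos-geometric r₀ j zero = trans (cong (_+ j) (*-zeroʳ r₀)) (sym (*-identityʳ j))
depthPos-geometric r₀ j (suc D) = begin
  r₀ * (j + suc r₀ * depthPos (suc r₀) j D) + j ≡⟨ lemma₁ r₀ j (depthPos (suc r₀) j D) ⟩
  suc r₀ * (r₀ * depthPos (suc r₀) j D + j)     ≡⟨ cong (suc r₀ *_) (depthPos-geometric r₀ j D) ⟩
  suc r₀ * (j * suc r₀ ^ D)                     ≡⟨ lemma₂ r₀ j (suc r₀ ^ D) ⟩
  j * (suc r₀ * suc r₀ ^ D)                     ∎
  where
  open ≡-Reasoning
  lemma₁ : ∀ r₀ j x → r₀ * (j + suc r₀ * x) + j ≡ suc r₀ * (r₀ * x + j)
  lemma₁ = solve-∀
  lemma₂ : ∀ r₀ j y → suc r₀ * (j * y) ≡ j * (suc r₀ * y)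
  lemma₂ = solve-∀

gapPower : ∀ {k} → Gap k → ℕ → Gap k
gapPower f zero = id
gapPower f (suc n) = f ∘g gapPower f n

module Depth {k} {w : Word (Alph k)} (T : OneGapToeplitz w) where
  open OneGapToeplitz T
  open ≡-Reasoning

  r : ℕ
  r = suc r₀

  J : ℕ → ℕ
  J = depthPos r j

  prepend-block : ∀ n N e₁ d → n * r ^ suc N + (e₁ * r + d) ≡ (n * r ^ N + e₁) * r + d
  prepend-block n N e₁ d = lemma n r (r ^ N) e₁ d
    where
    lemma : ∀ n a b e₁ d → n * (a * b) + (e₁ * a + d) ≡ (n * b + e₁) * a + d
    lemma = solve-∀

  depth-gap : ∀ N n → w (n * r ^ N + J N) ≡ gapPower f N ⟨$⟩ʳ w n
  depth-gap zero n = cong w (trans (+-identityʳ _) (*-identityʳ n))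
  depth-gap (suc N) n = begin
    w (n * (r * r ^ N) + (j + r * J N)) ≡⟨ cong w (lemma n r (r ^ N) j (J N)) ⟩
    w ((n * r ^ N + J N) * r + j)       ≡⟨ gapPos (n * r ^ N + J N) ⟩
    f ⟨$⟩ʳ w (n * r ^ N + J N)          ≡⟨ cong (f ⟨$⟩ʳ_) (depth-gap N n) ⟩
    f ⟨$⟩ʳ (gapPower f N ⟨$⟩ʳ w n)      ∎
    where
    lemma : ∀ n a b c d → n * (a * b) + (c + a * d) ≡ (n * b + d) * a + c
    lemma = solve-∀

  -- Every other position e of the n-th block repeats the first block: split off the last base-r
  -- digit d of e; if d ≠ j use letterPos, otherwise gapPos and induction on the remaining digits.
  depth-letter : ∀ N e n → e < r ^ N → e ≢ J N → w (n * r ^ N + e) ≡ w e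
  depth-letter zero zero n lt ne = ⊥-elim (ne refl)
  depth-letter zero (suc e) n (s≤s ()) ne
  depth-letter (suc N) e n lt ne with e % r ≟ j
  ... | no d≢j = begin
    w (n * r ^ suc N + e)            ≡⟨ cong w e≡ ⟩
    w ((n * r ^ N + e₁) * r + d)     ≡⟨ letterPos (n * r ^ N + e₁) d (m%n<n e r) d≢j ⟩
    w d                              ≡⟨ sym (letterPos e₁ d (m%n<n e r) d≢j) ⟩
    w (e₁ * r + d)                   ≡⟨ cong w (sym e-digits) ⟩
    w e                              ∎
    where
    d = e % r
    e₁ = e / r
    e-digits : e ≡ e₁ * r + d
    e-digits = trans (m≡m%n+[m/n]*n e r) (+-comm d (e₁ * r))
    e≡ : n * r ^ suc N + e ≡ (n * r ^ N + e₁) * r + d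
    e≡ = trans (cong (n * r ^ suc N +_) e-digits) (prepend-block n N e₁ d)
  ... | yes d≡j = begin
    w (n * r ^ suc N + e)            ≡⟨ cong w e≡ ⟩
    w ((n * r ^ N + e₁) * r + j)     ≡⟨ gapPos (n * r ^ N + e₁) ⟩
    f ⟨$⟩ʳ w (n * r ^ N + e₁)        ≡⟨ cong (f ⟨$⟩ʳ_) (depth-letter N e₁ n e₁<r^N e₁≢J) ⟩
    f ⟨$⟩ʳ w e₁                      ≡⟨ sym (gapPos e₁) ⟩
    w (e₁ * r + j)                   ≡⟨ cong w (sym e-digits) ⟩
    w e                              ∎
    where
    e₁ = e / r
    e-digits : e ≡ e₁ * r + j
    e-digits = trans (m≡m%n+[m/n]*n e r) (trans (+-comm (e % r) (e₁ * r)) (cong (e₁ * r +_) d≡j))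
    e≡ : n * r ^ suc N + e ≡ (n * r ^ N + e₁) * r + j
    e≡ = trans (cong (n * r ^ suc N +_) e-digits) (prepend-block n N e₁ j)
    e₁<r^N : e₁ < r ^ N
    e₁<r^N = m<n*o⇒m/o<n (subst (e <_) (*-comm r (r ^ N)) lt)
    e₁≢J : e₁ ≢ J N
    e₁≢J eq = ne (trans e-digits (trans (cong (λ x → x * r + j) eq)
                   (trans (+-comm (J N * r) j) (cong (j +_) (*-comm (J N) r)))))

  depth-letter-mod : ∀ N .{{_ : NonZero (r ^ N)}} x → x % r ^ N ≢ J N → w x ≡ w (x % r ^ N)
  depth-letter-mod N x ne = begin
    w x                                  ≡⟨ cong w (trans (m≡m%n+[m/n]*n x (r ^ N)) (+-comm (x % r ^ N) _)) ⟩
    w (x / r ^ N * r ^ N + x % r ^ N)    ≡⟨ depth-letter N (x % r ^ N) (x / r ^ N) (m%n<n x (r ^ N)) ne ⟩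
    w (x % r ^ N)                        ∎

periodic⇒toeplitz : ∀ {k} (u : Word (Alph k)) L .{{_ : NonZero L}} → (∀ t → u t ≡ u (t % L)) →
  ∃ λ (Q : List (Sym k)) → StartsWithLetter Q × IsToeplitzOf Q u
periodic⇒toeplitz u (suc L) per = Q , tt , toeplitz-criterion Q u λ n →
  inj₁ (trans (omega-applyUpTo (λ s → inj₁ (u s)) (suc L) n) (cong inj₁ (sym (per n))))
  where
  Q = applyUpTo (λ s → inj₁ (u s)) (suc L)

applyUpTo-startsWithLetter : ∀ {k} (g : ℕ → Sym k) L → 0 < L → IsLetter (g 0) → StartsWithLetter (applyUpTo g L)
applyUpTo-startsWithLetter g (suc L) _ (a , first) rewrite first = tt

transpose-sends : ∀ {n} (a b : Fin n) → transpose a b ⟨$⟩ʳ a ≡ b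
transpose-sends a b with a ≟ᶠ a
... | yes _ = refl
... | no a≢a = ⊥-elim (a≢a refl)

record SelfSimilar {k} (u : Word (Alph k)) : Set where
  field
    K R ρ e : ℕ
    φ : Gap k
    1≤G : 1 ≤ ρ + e * R
    room : ρ + e < R
    e<K : e < K
    jump : ∀ n → u (ρ + e * R + R * n) ≡ φ ⟨$⟩ʳ u n
    offPeriodic : ∀ q s → (∀ z → s ≢ ρ + e * R + R * z) → u (q * (K * R) + s) ≡ u s
    tailPeriodic : ∀ q i → i < K → K * R ≤ ρ + e * R + R * i → u (q * K + i) ≡ u i

2≤R : ∀ ρ e R → 1 ≤ ρ + e * R → ρ + e < R → 2 ≤ R
2≤R ρ e (suc (suc R)) _ _ = s≤s (s≤s z≤n)
2≤R zero zero (suc zero) () _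
2≤R zero (suc e) (suc zero) _ (s≤s ())
2≤R (suc ρ) e (suc zero) _ (s≤s ())

-- The pattern Q has length L = K R: its jump positions G + R z
-- (z = 0, …, K - e - 1, all before L - e) carry the gap φ, the remaining positions before L - e
-- carry the letters of u, and the last e positions carry gaps that bring the number of gaps per
-- period up to K; the gap at s ≥ L - e is filled from position s + K - L, and the transposition
-- exchanging the letters of u there and at s turns that letter into u s.
module SelfSimilarToeplitz {k} (u : Word (Alph k)) (S : SelfSimilar u) where
  open SelfSimilar S

  G L : ℕ
  G = ρ + e * R
  L = K * R

  1<R : 1 < R
  1<R = 2≤R ρ e R 1≤G room

  R′ : ℕ
  R′ = R ∸ 1

  R≡ : R ≡ suc R′
  R≡ = sym (m+[n∸m]≡n (<⇒≤ 1<R))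

  instance
    R≢0 : NonZero R
    R≢0 = >-nonZero (<-trans (s≤s z≤n) 1<R)
    K≢0 : NonZero K
    K≢0 = >-nonZero (≤-<-trans z≤n e<K)
    L≢0 : NonZero L
    L≢0 = m*n≢0 K R

  -- kk + 1 = K - e jump positions fall in the first period.
  kk : ℕ
  kk = K ∸ suc e

  K≡ : K ≡ e + suc kk
  K≡ = trans (sym (m+[n∸m]≡n e<K)) (sym (+-suc e kk))

  L≡ : L ≡ R * (e + suc kk)
  L≡ = trans (*-comm K R) (cong (R *_) K≡)

  K<L : K < L
  K<L = m<m*n K R 1<R

  e≤L : e ≤ L
  e≤L = ≤-trans (<⇒≤ e<K) (<⇒≤ K<L)

  G+Rz≡ : ∀ z → G + R * z ≡ ρ + R * (e + z)
  G+Rz≡ z = lemma ρ e R z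
    where
    lemma : ∀ ρ e R z → ρ + e * R + R * z ≡ ρ + R * (e + z)
    lemma = solve-∀

  IsJump : ℕ → Set
  IsJump s = Σ ℕ λ z → s ≡ G + R * z

  isJump? : ∀ s → Dec (IsJump s)
  isJump? s with G ≤? s
  ... | no G≰s = no λ { (z , refl) → G≰s (m≤m+n G (R * z)) }
  ... | yes G≤s with (s ∸ G) % R ≟ 0
  ...   | yes rem≡0 = yes ((s ∸ G) / R , (begin
    s                                    ≡⟨ sym (m+[n∸m]≡n G≤s) ⟩
    G + (s ∸ G)                          ≡⟨ cong (G +_) (m≡m%n+[m/n]*n (s ∸ G) R) ⟩
    G + ((s ∸ G) % R + (s ∸ G) / R * R)  ≡⟨ cong (λ x → G + (x + (s ∸ G) / R * R)) rem≡0 ⟩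
    G + (s ∸ G) / R * R                  ≡⟨ cong (G +_) (*-comm ((s ∸ G) / R) R) ⟩
    G + R * ((s ∸ G) / R)                ∎))
    where open ≡-Reasoning
  ...   | no rem≢0 = no λ { (z , refl) → rem≢0 (trans (cong (_% R) (trans (m+n∸m≡n G (R * z)) (*-comm R z))) (m*n%n≡0 z R)) }

  notJump-between : ∀ z o → suc o < R → ¬ IsJump (G + R * z + suc o)
  notJump-between z o lt (z′ , eq) = 0≢1+n (begin
    0                         ≡⟨ sym (m*n%n≡0 z′ R) ⟩
    (z′ * R) % R              ≡⟨ cong (_% R) (sym same) ⟩
    (suc o + z * R) % R       ≡⟨ [m+kn]%n≡m%n (suc o) z R ⟩
    suc o % R                 ≡⟨ m<n⇒m%n≡m lt ⟩
    suc o                     ∎)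
    where
    open ≡-Reasoning
    same : suc o + z * R ≡ z′ * R
    same = +-cancelˡ-≡ G _ _ (trans (lemma G R z o) (trans eq (cong (G +_) (*-comm R z′))))
      where
      lemma : ∀ G R z o → G + (suc o + z * R) ≡ G + R * z + suc o
      lemma = solve-∀

  -- The jump positions with index z ≤ kk, and only these, lie in the first period, and they lie
  -- before its last e positions; this is where ρ + e < R is needed.
  jump+e<L : ∀ z → z < suc kk → G + R * z + e < L
  jump+e<L z lt = begin-strict
    G + R * z + e            ≡⟨ cong (_+ e) (G+Rz≡ z) ⟩
    ρ + R * (e + z) + e      ≡⟨ lemma ρ R (e + z) e ⟩
    (ρ + e) + R * (e + z)    <⟨ +-monoˡ-< (R * (e + z)) room ⟩
    R + R * (e + z)          ≡⟨ sym (*-suc R (e + z)) ⟩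
    R * suc (e + z)          ≤⟨ *-monoʳ-≤ R (≤-trans (≤-reflexive (sym (+-suc e z))) (+-monoʳ-≤ e lt)) ⟩
    R * (e + suc kk)         ≡⟨ sym L≡ ⟩
    L                        ∎
    where
    open ≤-Reasoning
    lemma : ∀ ρ R x e → ρ + R * x + e ≡ (ρ + e) + R * x
    lemma = solve-∀

  jump<L∸e : ∀ z → z < suc kk → G + R * z < L ∸ e
  jump<L∸e z lt = m+n≤o⇒m≤o∸n (suc (G + R * z)) (jump+e<L z lt)

  jump<L⇒index≤kk : ∀ z → G + R * z < L → z < suc kk
  jump<L⇒index≤kk z lt = +-cancelˡ-< e z (suc kk) (*-cancelˡ-< R (e + z) (e + suc kk)
    (≤-<-trans (m≤n+m (R * (e + z)) ρ) (subst (_< R * (e + suc kk)) (G+Rz≡ z) (subst (G + R * z <_) L≡ lt))))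

  index>kk⇒L≤jump : ∀ z → suc kk ≤ z → L ≤ G + R * z
  index>kk⇒L≤jump z le = begin
    L                   ≡⟨ L≡ ⟩
    R * (e + suc kk)    ≤⟨ *-monoʳ-≤ R (+-monoʳ-≤ e le) ⟩
    R * (e + z)         ≤⟨ m≤n+m (R * (e + z)) ρ ⟩
    ρ + R * (e + z)     ≡⟨ sym (G+Rz≡ z) ⟩
    G + R * z           ∎
    where open ≤-Reasoning

  jumpInPeriod<L∸e : ∀ s → s < L → IsJump s → s < L ∸ e
  jumpInPeriod<L∸e s lt (z , refl) = jump<L∸e z (jump<L⇒index≤kk z lt)

  swapTo : ℕ → Gap k
  swapTo s = transpose (u (s + K ∸ L)) (u s)

  patternSym : ℕ → Sym k
  patternSym s with s <? L ∸ e | isJump? s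
  ... | yes _ | yes _ = inj₂ φ
  ... | yes _ | no _ = inj₁ (u s)
  ... | no _ | _ = inj₂ (swapTo s)

  patternSym-jump : ∀ s → s < L ∸ e → IsJump s → patternSym s ≡ inj₂ φ
  patternSym-jump s lt isJ with s <? L ∸ e | isJump? s
  ... | yes _ | yes _ = refl
  ... | yes _ | no ¬isJ = ⊥-elim (¬isJ isJ)
  ... | no ¬lt | _ = ⊥-elim (¬lt lt)

  patternSym-letter : ∀ s → s < L ∸ e → ¬ IsJump s → patternSym s ≡ inj₁ (u s)
  patternSym-letter s lt ¬isJ with s <? L ∸ e | isJump? s
  ... | yes _ | yes isJ = ⊥-elim (¬isJ isJ)
  ... | yes _ | no _ = refl
  ... | no ¬lt | _ = ⊥-elim (¬lt lt)

  patternSym-tail : ∀ s → L ∸ e ≤ s → patternSym s ≡ inj₂ (swapTo s)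
  patternSym-tail s le with s <? L ∸ e
  ... | yes lt = ⊥-elim (≤⇒≯ le lt)
  ... | no _ = refl

  lettersAfterJump : ∀ z m → m < R → G + R * z + m < L ∸ e →
    gapsBefore patternSym (suc (G + R * z) + m) ≡ gapsBefore patternSym (suc (G + R * z))
  lettersAfterJump z m m<R bound = gapsBefore-letters patternSym (suc (G + R * z)) m λ t t<m →
    subst (λ x → isGap (patternSym x) ≡ 0) (+-suc (G + R * z) t)
      (cong isGap (patternSym-letter (G + R * z + suc t)
        (≤-<-trans (+-monoʳ-≤ (G + R * z) t<m) bound)
        (notJump-between z t (<-≤-trans (s≤s t<m) m<R))))

  mutual
    gapsBefore-jump : ∀ z → z < suc kk → gapsBefore patternSym (G + R * z) ≡ z
    gapsBefore-jump zero lt = begin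
      gapsBefore patternSym (G + R * 0)   ≡⟨ cong (gapsBefore patternSym) (trans (cong (G +_) (*-zeroʳ R)) (+-identityʳ G)) ⟩
      gapsBefore patternSym (0 + G)       ≡⟨ gapsBefore-letters patternSym 0 G (λ t t<G → cong isGap (patternSym-letter t (below t<G) (notJump t<G))) ⟩
      0                                   ∎
      where
      open ≡-Reasoning
      below : ∀ {t} → t < G → t < L ∸ e
      below t<G = <-≤-trans t<G (≤-trans (m≤m+n G (R * 0)) (<⇒≤ (jump<L∸e 0 lt)))
      notJump : ∀ {t} → t < G → ¬ IsJump t
      notJump t<G (z , refl) = <⇒≱ t<G (m≤m+n G (R * z))
    gapsBefore-jump (suc z) lt = begin
      gapsBefore patternSym (G + R * suc z)              ≡⟨ cong (gapsBefore patternSym) position ⟩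
      gapsBefore patternSym (suc (G + R * z) + R′)       ≡⟨ lettersAfterJump z R′ (subst (R′ <_) (sym R≡) ≤-refl) bound ⟩
      gapsBefore patternSym (suc (G + R * z))            ≡⟨ gapsBefore-afterJump z (<-trans (n<1+n z) lt) ⟩
      suc z                                              ∎
      where
      open ≡-Reasoning
      position : G + R * suc z ≡ suc (G + R * z) + R′
      position = trans (cong (G +_) (*-suc R z)) (trans (cong (λ x → G + (x + R * z)) R≡) (lemma G R′ (R * z)))
        where
        lemma : ∀ G R′ x → G + (suc R′ + x) ≡ suc (G + x) + R′
        lemma = solve-∀
      bound : G + R * z + R′ < L ∸ e
      bound = <-trans (≤-reflexive (sym position)) (jump<L∸e (suc z) lt)

    gapsBefore-afterJump : ∀ z → z < suc kk → gapsBefore patternSym (suc (G + R * z)) ≡ suc z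
    gapsBefore-afterJump z lt = begin
      gapsBefore patternSym (suc (G + R * z))                                  ≡⟨ gapsBefore-suc patternSym (G + R * z) ⟩
      gapsBefore patternSym (G + R * z) + isGap (patternSym (G + R * z))
        ≡⟨ cong₂ _+_ (gapsBefore-jump z lt) (cong isGap (patternSym-jump _ (jump<L∸e z lt) (z , refl))) ⟩
      z + 1                                                                    ≡⟨ +-comm z 1 ⟩
      suc z                                                                    ∎
      where open ≡-Reasoning

  afterLast : ℕ
  afterLast = L ∸ e ∸ suc (G + R * kk)

  afterLast-split : suc (G + R * kk) + afterLast ≡ L ∸ e
  afterLast-split = m+[n∸m]≡n (jump<L∸e kk (n<1+n kk))

  afterLast<R : afterLast < R
  afterLast<R = +-cancelˡ-< (R * (e + kk)) afterLast R (begin-strict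
    R * (e + kk) + afterLast          ≤⟨ +-monoˡ-≤ afterLast (≤-trans (m≤n+m (R * (e + kk)) ρ) (≤-reflexive (sym (G+Rz≡ kk)))) ⟩
    G + R * kk + afterLast            <⟨ n<1+n _ ⟩
    suc (G + R * kk) + afterLast      ≡⟨ afterLast-split ⟩
    L ∸ e                             ≤⟨ m∸n≤m L e ⟩
    L                                 ≡⟨ trans L≡ (cong (R *_) (+-suc e kk)) ⟩
    R * suc (e + kk)                  ≡⟨ trans (*-suc R (e + kk)) (+-comm R _) ⟩
    R * (e + kk) + R                  ∎)
    where open ≤-Reasoning

  gapsBefore-L∸e : gapsBefore patternSym (L ∸ e) ≡ suc kk
  gapsBefore-L∸e = begin
    gapsBefore patternSym (L ∸ e)                         ≡⟨ cong (gapsBefore patternSym) (sym afterLast-split) ⟩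
    gapsBefore patternSym (suc (G + R * kk) + afterLast)  ≡⟨ lettersAfterJump kk afterLast afterLast<R (≤-reflexive afterLast-split) ⟩
    gapsBefore patternSym (suc (G + R * kk))              ≡⟨ gapsBefore-afterJump kk (n<1+n kk) ⟩
    suc kk                                                ∎
    where open ≡-Reasoning

  gapsBefore-tail : ∀ p → p ≤ e → gapsBefore patternSym (L ∸ e + p) ≡ suc kk + p
  gapsBefore-tail zero _ = trans (cong (gapsBefore patternSym) (+-identityʳ (L ∸ e))) (trans gapsBefore-L∸e (sym (+-identityʳ _)))
  gapsBefore-tail (suc p) le = begin
    gapsBefore patternSym (L ∸ e + suc p)                                   ≡⟨ cong (gapsBefore patternSym) (+-suc (L ∸ e) p) ⟩
    gapsBefore patternSym (suc (L ∸ e + p))                                 ≡⟨ gapsBefore-suc patternSym (L ∸ e + p) ⟩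
    gapsBefore patternSym (L ∸ e + p) + isGap (patternSym (L ∸ e + p))
      ≡⟨ cong₂ _+_ (gapsBefore-tail p (<⇒≤ le)) (cong isGap (patternSym-tail _ (m≤m+n (L ∸ e) p))) ⟩
    suc kk + p + 1                                                          ≡⟨ trans (+-assoc (suc kk) p 1) (cong (suc kk +_) (+-comm p 1)) ⟩
    suc kk + suc p                                                          ∎
    where open ≡-Reasoning

  gapsPerPeriod : gapsBefore patternSym L ≡ K
  gapsPerPeriod = begin
    gapsBefore patternSym L            ≡⟨ cong (gapsBefore patternSym) (sym (m∸n+n≡m e≤L)) ⟩
    gapsBefore patternSym (L ∸ e + e)  ≡⟨ gapsBefore-tail e ≤-refl ⟩
    suc kk + e                         ≡⟨ trans (+-comm (suc kk) e) (sym K≡) ⟩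
    K                                  ∎
    where open ≡-Reasoning

  Q : List (Sym k)
  Q = applyUpTo patternSym L

  omegaQ : ∀ q s → s < L → omega Q (q * L + s) ≡ patternSym s
  omegaQ q s lt = trans (omega-applyUpTo patternSym L (q * L + s))
    (cong patternSym (trans (cong (_% L) (+-comm (q * L) s)) (trans ([m+kn]%n≡m%n s q L) (m<n⇒m%n≡m lt))))

  gapsBeforeQ : ∀ q s → s < L → gapsBefore (omega Q) (q * L + s) ≡ q * K + gapsBefore patternSym s
  gapsBeforeQ q s lt = begin
    gapsBefore (omega Q) (q * L + s)                               ≡⟨ gapsBefore-periodic (omega Q) L Q-periodic q s ⟩
    q * gapsBefore (omega Q) L + gapsBefore (omega Q) s            ≡⟨ cong₂ (λ x y → q * x + y) (agree L ≤-refl) (agree s (<⇒≤ lt)) ⟩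
    q * gapsBefore patternSym L + gapsBefore patternSym s          ≡⟨ cong (λ x → q * x + gapsBefore patternSym s) gapsPerPeriod ⟩
    q * K + gapsBefore patternSym s                                ∎
    where
    open ≡-Reasoning
    Q-periodic : ∀ t → omega Q (L + t) ≡ omega Q t
    Q-periodic t = trans (omega-applyUpTo patternSym L (L + t))
      (trans (cong patternSym (trans (cong (_% L) (+-comm L t)) ([m+n]%n≡m%n t L))) (sym (omega-applyUpTo patternSym L t)))
    agree : ∀ n → n ≤ L → gapsBefore (omega Q) n ≡ gapsBefore patternSym n
    agree n n≤L = gapsBefore-ext (omega Q) patternSym n λ t t<n → omegaQ 0 t (<-≤-trans t<n n≤L)

  -- The tail position L - e + p is filled from position K - e + p = (L - e + p) + K - L, which
  -- comes earlier since K < L.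
  tail-source : ∀ p → L ∸ e + p + K ∸ L ≡ suc kk + p
  tail-source p = begin
    L ∸ e + p + K ∸ L                 ≡⟨ cong (λ y → L ∸ e + p + y ∸ L) K≡ ⟩
    L ∸ e + p + (e + suc kk) ∸ L      ≡⟨ cong (_∸ L) (lemma (L ∸ e) p e (suc kk)) ⟩
    (L ∸ e + e) + (suc kk + p) ∸ L    ≡⟨ cong (λ x → x + (suc kk + p) ∸ L) (m∸n+n≡m e≤L) ⟩
    L + (suc kk + p) ∸ L              ≡⟨ m+n∸m≡n L (suc kk + p) ⟩
    suc kk + p                        ∎
    where
    open ≡-Reasoning
    lemma : ∀ a p e s → a + p + (e + s) ≡ (a + e) + (s + p)
    lemma = solve-∀

  jumpCount<L∸e : suc kk < L ∸ e
  jumpCount<L∸e = m+n≤o⇒m≤o∸n (suc (suc kk)) (subst (_< L) (sym (trans (+-comm (suc kk) e) (sym K≡))) K<L)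

  -- Each of the three kinds of positions is locally generated: jump positions by the
  -- self-similarity, letters by the L-periodicity, tail gaps through the K-periodicity of their
  -- filling positions.
  generated-jump : ∀ q s → s < L → IsJump s → LocallyGenerated Q u (q * L + s)
  generated-jump q s lt (z , refl) = inj₂ (φ , symbol , filled , earlier)
    where
    gaps : gapsBefore (omega Q) (q * L + s) ≡ q * K + z
    gaps = trans (gapsBeforeQ q s lt) (cong (q * K +_) (gapsBefore-jump z (jump<L⇒index≤kk z lt)))
    position : q * L + s ≡ G + R * (q * K + z)
    position = lemma q K R G z
      where
      lemma : ∀ q K R G z → q * (K * R) + (G + R * z) ≡ G + R * (q * K + z)
      lemma = solve-∀
    symbol : omega Q (q * L + s) ≡ inj₂ φ
    symbol = trans (omegaQ q s lt) (patternSym-jump s (jumpInPeriod<L∸e s lt (z , refl)) (z , refl))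
    filled : u (q * L + s) ≡ φ ⟨$⟩ʳ u (gapsBefore (omega Q) (q * L + s))
    filled = trans (cong u position) (trans (jump (q * K + z)) (cong (λ x → φ ⟨$⟩ʳ u x) (sym gaps)))
    earlier : gapsBefore (omega Q) (q * L + s) < q * L + s
    earlier = subst₂ _<_ (sym gaps) (sym position)
      (<-≤-trans (n<1+n (q * K + z)) (+-mono-≤ 1≤G (m≤n*m (q * K + z) R)))

  generated-letter : ∀ q s → s < L → s < L ∸ e → ¬ IsJump s → LocallyGenerated Q u (q * L + s)
  generated-letter q s lt lt′ ¬isJ = inj₁ (trans (omegaQ q s lt) (trans (patternSym-letter s lt′ ¬isJ)
    (cong inj₁ (sym (offPeriodic q s (λ z eq → ¬isJ (z , eq)))))))

  generated-tail : ∀ q s → s < L → L ∸ e ≤ s → LocallyGenerated Q u (q * L + s)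
  generated-tail q s lt le = inj₂ (swapTo s , trans (omegaQ q s lt) (patternSym-tail s le) , filled , earlier)
    where
    p = s ∸ (L ∸ e)
    s≡ : s ≡ L ∸ e + p
    s≡ = sym (m+[n∸m]≡n le)
    p<e : p < e
    p<e = +-cancelˡ-< (L ∸ e) p e (subst₂ _<_ s≡ (sym (m∸n+n≡m e≤L)) lt)
    i = suc kk + p
    i<K : i < K
    i<K = subst (i <_) (trans (+-comm (suc kk) e) (sym K≡)) (+-monoʳ-< (suc kk) p<e)
    gaps : gapsBefore (omega Q) (q * L + s) ≡ q * K + i
    gaps = trans (gapsBeforeQ q s lt) (cong (q * K +_) (trans (cong (gapsBefore patternSym) s≡) (gapsBefore-tail p (<⇒≤ p<e))))
    source : s + K ∸ L ≡ i
    source = trans (cong (λ x → x + K ∸ L) s≡) (tail-source p)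
    filled : u (q * L + s) ≡ swapTo s ⟨$⟩ʳ u (gapsBefore (omega Q) (q * L + s))
    filled = begin
      u (q * L + s)                                     ≡⟨ offPeriodic q s (λ z eq → ≤⇒≯ le (jumpInPeriod<L∸e s lt (z , eq))) ⟩
      u s                                               ≡⟨ sym (transpose-sends (u (s + K ∸ L)) (u s)) ⟩
      swapTo s ⟨$⟩ʳ u (s + K ∸ L)                       ≡⟨ cong (λ x → swapTo s ⟨$⟩ʳ u x) source ⟩
      swapTo s ⟨$⟩ʳ u i
        ≡⟨ cong (swapTo s ⟨$⟩ʳ_) (sym (tailPeriodic q i i<K (index>kk⇒L≤jump i (m≤m+n (suc kk) p)))) ⟩
      swapTo s ⟨$⟩ʳ u (q * K + i)                       ≡⟨ cong (λ x → swapTo s ⟨$⟩ʳ u x) (sym gaps) ⟩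
      swapTo s ⟨$⟩ʳ u (gapsBefore (omega Q) (q * L + s)) ∎
      where open ≡-Reasoning
    i<s : i < s
    i<s = subst (i <_) (sym s≡) (+-monoˡ-< p jumpCount<L∸e)
    earlier : gapsBefore (omega Q) (q * L + s) < q * L + s
    earlier = subst (_< q * L + s) (sym gaps) (+-mono-≤-< (*-monoʳ-≤ q (<⇒≤ K<L)) i<s)

  generated : ∀ n → LocallyGenerated Q u n
  generated n = subst (LocallyGenerated Q u) (sym n≡) (classify (n % L) (m%n<n n L))
    where
    n≡ : n ≡ n / L * L + n % L
    n≡ = trans (m≡m%n+[m/n]*n n L) (+-comm (n % L) _)
    classify : ∀ s → s < L → LocallyGenerated Q u (n / L * L + s)
    classify s lt with s <? L ∸ e | isJump? s
    ... | _ | yes isJ = generated-jump (n / L) s lt isJ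
    ... | yes lt′ | no ¬isJ = generated-letter (n / L) s lt lt′ ¬isJ
    ... | no ¬lt′ | no _ = generated-tail (n / L) s lt (≮⇒≥ ¬lt′)

  startsWithLetter : StartsWithLetter Q
  startsWithLetter = applyUpTo-startsWithLetter patternSym L (>-nonZero⁻¹ L) (u 0 , first)
    where
    first : patternSym 0 ≡ inj₁ (u 0)
    first = patternSym-letter 0 (≤-<-trans z≤n (jump<L∸e 0 (s≤s z≤n))) λ { (z , eq) → <⇒≢ (≤-trans 1≤G (m≤m+n G (R * z))) eq }

selfSimilar⇒toeplitz : ∀ {k} (u : Word (Alph k)) → SelfSimilar u →
  ∃ λ (Q : List (Sym k)) → StartsWithLetter Q × IsToeplitzOf Q u
selfSimilar⇒toeplitz u S = Q , startsWithLetter , toeplitz-criterion Q u generated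
  where open SelfSimilarToeplitz u S

module Congruence (b₀ : ℕ) where
  b : ℕ
  b = suc b₀

  infix 4 _≈_
  record _≈_ (x y : ℕ) : Set where
    constructor mk≈
    field residues : x % b ≡ y % b

  ≈-refl : ∀ {x} → x ≈ x
  ≈-refl = mk≈ refl

  ≈-reflexive : ∀ {x y} → x ≡ y → x ≈ y
  ≈-reflexive refl = ≈-refl

  ≈-sym : ∀ {x y} → x ≈ y → y ≈ x
  ≈-sym (mk≈ e) = mk≈ (sym e)

  ≈-trans : ∀ {x y z} → x ≈ y → y ≈ z → x ≈ z
  ≈-trans (mk≈ e) (mk≈ e′) = mk≈ (trans e e′)

  ≈-+ : ∀ {x x′ y y′} → x ≈ x′ → y ≈ y′ → x + y ≈ x′ + y′
  ≈-+ {x} {x′} {y} {y′} (mk≈ e) (mk≈ e′) =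
    mk≈ (trans (%-distribˡ-+ x y b) (trans (cong₂ (λ m n → (m + n) % b) e e′) (sym (%-distribˡ-+ x′ y′ b))))

  ≈-* : ∀ {x x′ y y′} → x ≈ x′ → y ≈ y′ → x * y ≈ x′ * y′
  ≈-* {x} {x′} {y} {y′} (mk≈ e) (mk≈ e′) =
    mk≈ (trans (%-distribˡ-* x y b) (trans (cong₂ (λ m n → (m * n) % b) e e′) (sym (%-distribˡ-* x′ y′ b))))

  b*≈0 : ∀ x → b * x ≈ 0
  b*≈0 x = mk≈ (trans (cong (_% b) (*-comm b x)) (m*n%n≡0 x b))

  +b*≈ : ∀ x z → x + b * z ≈ x
  +b*≈ x z = ≈-trans (≈-+ (≈-refl {x}) (b*≈0 z)) (≈-reflexive (+-identityʳ x))

  ≈0⇒∣ : ∀ {x} → x ≈ 0 → b ∣ x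
  ≈0⇒∣ {x} (mk≈ e) = m%n≡0⇒n∣m x b e

  ∣⇒≈0 : ∀ {x} → b ∣ x → x ≈ 0
  ∣⇒≈0 {x} d = mk≈ (n∣m⇒m%n≡0 x b d)

  record EventualPeriod (r : ℕ) : Set where
    field
      M₁ p : ℕ
      1≤p : 1 ≤ p
      periodic : ∀ t M → M₁ ≤ M → r ^ (M + t * p) ≈ r ^ M

  -- By the pigeonhole principle two of r^0, …, r^b agree modulo b.
  eventualPeriod : ∀ r → EventualPeriod r
  eventualPeriod r with pigeonhole (≤-refl {suc b}) (λ (i : Fin (suc b)) → fromℕ< (m%n<n (r ^ toℕ i) b))
  ... | i , i′ , i<i′ , same = record { M₁ = toℕ i ; p = toℕ i′ ∸ toℕ i ; 1≤p = m<n⇒0<n∸m i<i′ ; periodic = periodic }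
    where
    p = toℕ i′ ∸ toℕ i
    r^i≈r^i′ : r ^ toℕ i ≈ r ^ toℕ i′
    r^i≈r^i′ = mk≈ (trans (sym (toℕ-fromℕ< (m%n<n (r ^ toℕ i) b))) (trans (cong toℕ same) (toℕ-fromℕ< (m%n<n (r ^ toℕ i′) b))))
    onePeriod : ∀ M → toℕ i ≤ M → r ^ (M + p) ≈ r ^ M
    onePeriod M le = ≈-trans (≈-reflexive (cong (r ^_) exponent)) (≈-trans (≈-reflexive (^-distribˡ-+-* r d (toℕ i′)))
      (≈-trans (≈-* (≈-refl {r ^ d}) (≈-sym r^i≈r^i′)) (≈-reflexive (trans (sym (^-distribˡ-+-* r d (toℕ i))) (cong (r ^_) (m∸n+n≡m le))))))
      where
      open ≡-Reasoning
      d = M ∸ toℕ i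
      exponent : M + p ≡ d + toℕ i′
      exponent = begin
        M + p                       ≡⟨ cong (_+ p) (sym (m∸n+n≡m le)) ⟩
        d + toℕ i + p               ≡⟨ +-assoc d (toℕ i) p ⟩
        d + (toℕ i + p)             ≡⟨ cong (d +_) (m+[n∸m]≡n (<⇒≤ i<i′)) ⟩
        d + toℕ i′                  ∎
    periodic : ∀ t M → toℕ i ≤ M → r ^ (M + t * p) ≈ r ^ M
    periodic zero M le = ≈-reflexive (cong (r ^_) (+-identityʳ M))
    periodic (suc t) M le = ≈-trans (≈-reflexive (cong (r ^_) (sym (+-assoc M p (t * p)))))
      (≈-trans (periodic t (M + p) (≤-trans le (m≤m+n M p))) (onePeriod M le))

-- Otherwise either B (e + 1) < W, which forces R < W, or W ≤ B (e + 1), which forces W ≤ B e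
-- while B e < W.
digits-room : ∀ B W R e ρ → 1 ≤ B → 1 ≤ W → B * (ρ + e * R) + W ≡ W * R → ρ < R → W ≤ R → ρ + e < R
digits-room B W R e ρ 1≤B 1≤W eq ρ<R W≤R with R ≤? ρ + e
... | no R≰ = ≰⇒> R≰
... | yes R≤ with suc (B * suc e) ≤? W
...   | yes big = ⊥-elim (<⇒≱ R<W W≤R)
  where
  open ≤-Reasoning
  R<W : R < W
  R<W = +-cancelˡ-< (B * suc e * R) R W (begin-strict
    B * suc e * R + R              ≡⟨ lemma B e R ⟩
    suc (B * suc e) * R            ≤⟨ *-monoˡ-≤ R big ⟩
    W * R                          ≡⟨ sym eq ⟩
    B * (ρ + e * R) + W            <⟨ +-monoˡ-< W (*-monoʳ-< B {{>-nonZero 1≤B}} (+-monoˡ-< (e * R) ρ<R)) ⟩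
    B * (suc e * R) + W            ≡⟨ cong (_+ W) (sym (*-assoc B (suc e) R)) ⟩
    B * suc e * R + W              ∎)
    where
    lemma : ∀ B e R → B * suc e * R + R ≡ suc (B * suc e) * R
    lemma = solve-∀
...   | no small = ⊥-elim (<⇒≱ Be<W W≤Be)
  where
  open ≤-Reasoning
  G = ρ + e * R
  BG<WR : B * G < W * R
  BG<WR = subst (B * G <_) eq (≤-trans (≤-reflexive (+-comm 1 (B * G))) (+-monoʳ-≤ (B * G) 1≤W))
  Be<W : B * e < W
  Be<W = *-cancelʳ-< R (B * e) W (≤-<-trans (≤-trans (≤-reflexive (*-assoc B e R)) (*-monoʳ-≤ B (m≤n+m (e * R) ρ))) BG<WR)
  W≤Be : W ≤ B * e
  W≤Be = +-cancelˡ-≤ (B * G) W (B * e) (begin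
    B * G + W              ≡⟨ eq ⟩
    W * R                  ≤⟨ *-monoˡ-≤ R (≤-pred (≰⇒> small)) ⟩
    B * suc e * R          ≡⟨ *-assoc B (suc e) R ⟩
    B * (R + e * R)        ≤⟨ *-monoʳ-≤ B (≤-trans (+-monoˡ-≤ (e * R) R≤) (≤-reflexive (lemma ρ e R))) ⟩
    B * (G + e)            ≡⟨ *-distribˡ-+ B G e ⟩
    B * G + B * e          ∎)
    where
    lemma : ∀ ρ e R → ρ + e + e * R ≡ ρ + e * R + e
    lemma = solve-∀

module Subsequence {k} {w : Word (Alph k)} (T : OneGapToeplitz w) (b₀ c : ℕ) where
  open OneGapToeplitz T
  open Depth T
  open Congruence b₀

  u : Word (Alph k)
  u t = w (c + b * t)

  shift-invariant : ∀ N .{{_ : NonZero (r ^ N)}} q s → (c + b * s) % r ^ N ≢ J N → u (q * r ^ N + s) ≡ u s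
  shift-invariant N q s miss = begin
    w (c + b * (q * r ^ N + s))           ≡⟨ depth-letter-mod N _ (λ hit → miss (trans (sym same-residue) hit)) ⟩
    w ((c + b * (q * r ^ N + s)) % r ^ N) ≡⟨ cong w same-residue ⟩
    w ((c + b * s) % r ^ N)               ≡⟨ sym (depth-letter-mod N (c + b * s) miss) ⟩
    w (c + b * s)                         ∎
    where
    open ≡-Reasoning
    same-residue : (c + b * (q * r ^ N + s)) % r ^ N ≡ (c + b * s) % r ^ N
    same-residue = trans (cong (_% r ^ N) (lemma c b q (r ^ N) s)) ([m+kn]%n≡m%n (c + b * s) (b * q) (r ^ N))
      where
      lemma : ∀ c b q R s → c + b * (q * R + s) ≡ (c + b * s) + (b * q) * R
      lemma = solve-∀

  misses⇒periodic : ∀ N .{{_ : NonZero (r ^ N)}} → (∀ s → s < r ^ N → (c + b * s) % r ^ N ≢ J N) →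
    ∀ t → u t ≡ u (t % r ^ N)
  misses⇒periodic N miss t = trans (cong u (trans (m≡m%n+[m/n]*n t (r ^ N)) (+-comm (t % r ^ N) _)))
    (shift-invariant N (t / r ^ N) (t % r ^ N) (miss (t % r ^ N) (m%n<n t (r ^ N))))

  -- excess D = r^D c + J D - c: the distance from c to the depth-D gap position filled from c.
  excess : ℕ → ℕ
  excess zero = 0
  excess (suc D) = r * excess D + (r₀ * c + j)

  excess+c : ∀ D → excess D + c ≡ r ^ D * c + J D
  excess+c zero = sym (trans (+-identityʳ _) (+-identityʳ c))
  excess+c (suc D) = begin
    r * excess D + (r₀ * c + j) + c ≡⟨ lemma₁ r₀ (excess D) c j ⟩
    r * (excess D + c) + j          ≡⟨ cong (λ x → r * x + j) (excess+c D) ⟩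
    r * (r ^ D * c + J D) + j       ≡⟨ lemma₂ r₀ (r ^ D) c (J D) j ⟩
    r * r ^ D * c + (j + r * J D)   ∎
    where
    open ≡-Reasoning
    lemma₁ : ∀ r₀ x c j → suc r₀ * x + (r₀ * c + j) + c ≡ suc r₀ * (x + c) + j
    lemma₁ = solve-∀
    lemma₂ : ∀ r₀ y c z j → suc r₀ * (y * c + z) + j ≡ suc r₀ * y * c + (j + suc r₀ * z)
    lemma₂ = solve-∀

  excess-+ : ∀ E D → excess (E + D) ≡ r ^ D * excess E + excess D
  excess-+ E D = +-cancelʳ-≡ c _ _ (begin
    excess (E + D) + c                                ≡⟨ excess+c (E + D) ⟩
    r ^ (E + D) * c + J (E + D)                       ≡⟨ cong₂ (λ x y → x * c + y) (^-distribˡ-+-* r E D) (depthPos-+ r j E D) ⟩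
    r ^ E * r ^ D * c + (r ^ D * J E + J D)           ≡⟨ lemma₁ (r ^ E) (r ^ D) c (J E) (J D) ⟩
    r ^ D * (r ^ E * c + J E) + J D                   ≡⟨ cong (λ x → r ^ D * x + J D) (sym (excess+c E)) ⟩
    r ^ D * (excess E + c) + J D                      ≡⟨ lemma₂ (r ^ D) (excess E) c (J D) ⟩
    r ^ D * excess E + (r ^ D * c + J D)              ≡⟨ cong (r ^ D * excess E +_) (sym (excess+c D)) ⟩
    r ^ D * excess E + (excess D + c)                 ≡⟨ sym (+-assoc (r ^ D * excess E) (excess D) c) ⟩
    r ^ D * excess E + excess D + c                   ∎)
    where
    open ≡-Reasoning
    lemma₁ : ∀ a b c x y → a * b * c + (b * x + y) ≡ b * (a * c + x) + y
    lemma₁ = solve-∀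
    lemma₂ : ∀ a x c y → a * (x + c) + y ≡ a * x + (a * c + y)
    lemma₂ = solve-∀

  excess-* : ∀ D t → b ∣ excess D → b ∣ excess (t * D)
  excess-* D zero _ = divides 0 refl
  excess-* D (suc t) b∣ = subst (b ∣_) (sym (excess-+ D (t * D))) (∣m∣n⇒∣m+n (∣n⇒∣m*n (r ^ (t * D)) b∣) (excess-* D t b∣))

  open EventualPeriod (eventualPeriod r)

  cancel-period : ∀ M D y → M₁ ≤ M → ∀ t → D ≡ t * p → b ∣ r ^ (M + D) * y → b ∣ r ^ M * y
  cancel-period M D y le t refl b∣ = ≈0⇒∣ (≈-trans (≈-sym (≈-* (periodic t M le) (≈-refl {y}))) (∣⇒≈0 b∣))

  -- For N ≥ M₁ a multiple of the period, r^(iN) r^N ≡ r^N; hence a congruence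
  -- excess N + A r^N ≡ r^N c propagates to i shifted copies: excess (iN) = Σ r^(i'N) excess N.
  excess-copies : ∀ t N A → N ≡ t * p → M₁ ≤ N → excess N + A * r ^ N ≈ r ^ N * c →
    ∀ i → excess (i * N) + i * (A * r ^ N) ≈ i * (r ^ N * c)
  excess-copies t N A N≡ le one zero = ≈-refl
  excess-copies t N A N≡ le one (suc i) =
    ≈-trans (≈-reflexive (trans (cong (_+ suc i * a) (excess-+ N (i * N))) (lemma (q * excess N) (excess (i * N)) a (i * a))))
      (≈-+ shifted (excess-copies t N A N≡ le one i))
    where
    a = A * r ^ N
    m = r ^ N * c
    q = r ^ (i * N)
    lemma : ∀ x y a ia → x + y + (a + ia) ≡ (x + a) + (y + ia)
    lemma = solve-∀
    qr^N≈r^N : q * r ^ N ≈ r ^ N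
    qr^N≈r^N = ≈-trans (≈-reflexive (trans (*-comm q (r ^ N)) (trans (sym (^-distribˡ-+-* r N (i * N)))
      (cong (λ x → r ^ (N + x)) (trans (cong (i *_) N≡) (sym (*-assoc i t p))))))) (periodic (i * t) N le)
    qa≈a : q * a ≈ a
    qa≈a = ≈-trans (≈-reflexive (lemma′ q A (r ^ N))) (≈-* (≈-refl {A}) qr^N≈r^N)
      where
      lemma′ : ∀ q A R → q * (A * R) ≡ A * (q * R)
      lemma′ = solve-∀
    qm≈m : q * m ≈ m
    qm≈m = ≈-trans (≈-reflexive (sym (*-assoc q (r ^ N) c))) (≈-* qr^N≈r^N (≈-refl {c}))
    shifted : q * excess N + a ≈ m
    shifted = ≈-trans (≈-+ (≈-refl {q * excess N}) (≈-sym qa≈a)) (≈-trans (≈-reflexive (sym (*-distribˡ-+ q (excess N) a)))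
      (≈-trans (≈-* (≈-refl {q}) one) qm≈m))

  -- If c + b s lies in the depth-N gap class, where N ≥ M₁ is a multiple of the period, then
  -- b divides excess (b N): writing c + b s = J N + A r^N gives excess N + A r^N ≡ r^N c, and
  -- b copies give excess (b N) + b A r^N ≡ b r^N c ≡ 0.
  hit⇒b∣excess : ∀ t N .{{_ : NonZero (r ^ N)}} → N ≡ t * p → M₁ ≤ N → ∀ s → (c + b * s) % r ^ N ≡ J N → b ∣ excess (b * N)
  hit⇒b∣excess t N N≡ le s hit =
    ≈0⇒∣ (≈-trans (≈-sym (+b*≈ (excess (b * N)) a)) (≈-trans (excess-copies t N A N≡ le one b) (b*≈0 m)))
    where
    A = (c + b * s) / r ^ N
    a = A * r ^ N
    m = r ^ N * c
    c+bs≡ : c + b * s ≡ J N + a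
    c+bs≡ = trans (m≡m%n+[m/n]*n (c + b * s) (r ^ N)) (cong (_+ a) hit)
    one : excess N + a ≈ m
    one = ≈-trans (≈-reflexive (+-cancelʳ-≡ c (excess N + a) (m + b * s) (begin
      excess N + a + c       ≡⟨ lemma₁ (excess N) a c ⟩
      excess N + c + a       ≡⟨ cong (_+ a) (excess+c N) ⟩
      m + J N + a            ≡⟨ +-assoc m (J N) a ⟩
      m + (J N + a)          ≡⟨ cong (m +_) (sym c+bs≡) ⟩
      m + (c + b * s)        ≡⟨ lemma₂ m c (b * s) ⟩
      m + b * s + c          ∎))) (+b*≈ m s)
      where
      open ≡-Reasoning
      lemma₁ : ∀ x a c → x + a + c ≡ x + c + a
      lemma₁ = solve-∀
      lemma₂ : ∀ m c y → m + (c + y) ≡ m + y + c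
      lemma₂ = solve-∀

  -- Parameters of a self-similarity of u: with R = r^D and G = ρ + e R, c + b G is the depth-D
  -- gap position r^D c + J D filled from c, so that u (G + R n) = f^D (u n) for all n.  M is a
  -- larger depth at which the progression is again aligned with the gap classes.
  record Renormalisation : Set where
    field
      D M ρ e : ℕ
      1≤D : 1 ≤ D
      firstJump : b * (ρ + e * r ^ D) + c ≡ r ^ D * c + J D
      b∣excessM : b ∣ excess M
      cancel : ∀ y → b ∣ r ^ (M + D) * y → b ∣ r ^ M * y
      c<JM : c < J M
      room : ρ + e < r ^ D

  module FromRenormalisation (Rn : Renormalisation) where
    open Renormalisation Rn

    R K L G : ℕ
    R = r ^ D
    K = r ^ M
    L = r ^ (M + D)
    G = ρ + e * R

    instance
      R≢0 : NonZero R
      R≢0 = m^n≢0 r D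
      K≢0 : NonZero K
      K≢0 = m^n≢0 r M
      L≢0 : NonZero L
      L≢0 = m^n≢0 r (M + D)

    L≡KR : L ≡ K * R
    L≡KR = ^-distribˡ-+-* r M D

    J[M+D] : J (M + D) ≡ R * J M + J D
    J[M+D] = depthPos-+ r j M D

    jump : ∀ n → u (G + R * n) ≡ gapPower f D ⟨$⟩ʳ u n
    jump n = trans (cong w position) (depth-gap D (c + b * n))
      where
      open ≡-Reasoning
      position : c + b * (G + R * n) ≡ (c + b * n) * R + J D
      position = begin
        c + b * (G + R * n)            ≡⟨ lemma₁ c b G R n ⟩
        (b * G + c) + b * R * n        ≡⟨ cong (_+ b * R * n) firstJump ⟩
        R * c + J D + b * R * n        ≡⟨ lemma₂ R c (J D) b n ⟩
        (c + b * n) * R + J D          ∎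
        where
        lemma₁ : ∀ c b G R n → c + b * (G + R * n) ≡ (b * G + c) + b * R * n
        lemma₁ = solve-∀
        lemma₂ : ∀ R c J b n → R * c + J + b * R * n ≡ (c + b * n) * R + J
        lemma₂ = solve-∀

    -- A term of the progression in the depth-(M+D) gap class: b s = R Z + b G, where Z is, up to a
    -- multiple of b, a multiple of K plus excess M.
    hit⇒offset : ∀ s → (c + b * s) % L ≡ J (M + D) →
      Σ ℕ λ Z → Σ ℕ λ y → (b * s ≡ R * Z + b * G) × (Z + b * K * c ≡ K * y + excess M)
    hit⇒offset s hit = Z , A + b₀ * c , bs≡ , Z≡
      where
      open ≡-Reasoning
      A = (c + b * s) / L
      c+bs≡ : c + b * s ≡ J (M + D) + A * L
      c+bs≡ = trans (m≡m%n+[m/n]*n (c + b * s) L) (cong (_+ A * L) hit)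
      Y = J M + A * K
      bs+Rc≡ : b * s + R * c ≡ R * Y + b * G
      bs+Rc≡ = +-cancelʳ-≡ (c + J D) _ _ (begin
        b * s + R * c + (c + J D)                          ≡⟨ lemma₁ (b * s) (R * c) c (J D) ⟩
        (c + b * s) + (R * c + J D)                        ≡⟨ cong₂ _+_ c+bs≡ (sym firstJump) ⟩
        (J (M + D) + A * L) + (b * G + c)                  ≡⟨ cong₂ (λ x y → (x + A * y) + (b * G + c)) J[M+D] L≡KR ⟩
        (R * J M + J D + A * (K * R)) + (b * G + c)        ≡⟨ lemma₂ R (J M) (J D) A K (b * G) c ⟩
        R * Y + b * G + (c + J D)                          ∎)
        where
        lemma₁ : ∀ x y c j → x + y + (c + j) ≡ (c + x) + (y + j)
        lemma₁ = solve-∀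
        lemma₂ : ∀ R JM JD A K bg c → (R * JM + JD + A * (K * R)) + (bg + c) ≡ R * (JM + A * K) + bg + (c + JD)
        lemma₂ = solve-∀
      c≤Y : c ≤ Y
      c≤Y = ≤-trans (<⇒≤ c<JM) (m≤m+n (J M) (A * K))
      Z = Y ∸ c
      Y≡ : Y ≡ c + Z
      Y≡ = sym (m+[n∸m]≡n c≤Y)
      bs≡ : b * s ≡ R * Z + b * G
      bs≡ = +-cancelʳ-≡ (R * c) _ _ (begin
        b * s + R * c            ≡⟨ bs+Rc≡ ⟩
        R * Y + b * G            ≡⟨ cong (λ x → R * x + b * G) Y≡ ⟩
        R * (c + Z) + b * G      ≡⟨ lemma R c Z (b * G) ⟩
        R * Z + b * G + R * c    ∎)
        where
        lemma : ∀ R c Z g → R * (c + Z) + g ≡ R * Z + g + R * c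
        lemma = solve-∀
      Z≡ : Z + b * K * c ≡ K * (A + b₀ * c) + excess M
      Z≡ = +-cancelʳ-≡ c _ _ (begin
        Z + b * K * c + c                        ≡⟨ lemma₁ Z b₀ K c ⟩
        (c + Z) + b * K * c                      ≡⟨ cong (_+ b * K * c) (sym Y≡) ⟩
        J M + A * K + b * K * c                  ≡⟨ lemma₂ (J M) A K b₀ c ⟩
        K * (A + b₀ * c) + (K * c + J M)         ≡⟨ cong (K * (A + b₀ * c) +_) (sym (excess+c M)) ⟩
        K * (A + b₀ * c) + (excess M + c)        ≡⟨ sym (+-assoc (K * (A + b₀ * c)) (excess M) c) ⟩
        K * (A + b₀ * c) + excess M + c          ∎)
        where
        lemma₁ : ∀ Z b₀ K c → Z + suc b₀ * K * c + c ≡ (c + Z) + suc b₀ * K * c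
        lemma₁ = solve-∀
        lemma₂ : ∀ J A K b₀ c → J + A * K + suc b₀ * K * c ≡ K * (A + b₀ * c) + (K * c + J)
        lemma₂ = solve-∀

    -- If b ∣ R Z then b ∣ Z: b divides R K y, hence (cancelling R = r^D) K y, hence Z.
    offset-divisible : ∀ Z y → b ∣ R * Z → Z + b * K * c ≡ K * y + excess M → b ∣ Z
    offset-divisible Z y b∣RZ Z≡ = ∣m+n∣m⇒∣n (subst (b ∣_) (trans (sym Z≡) (+-comm Z (b * K * c))) (∣m∣n⇒∣m+n b∣Ky b∣excessM)) b∣bKc
      where
      b∣bKc : b ∣ b * K * c
      b∣bKc = subst (b ∣_) (sym (*-assoc b K c)) (m∣m*n (K * c))
      b∣R[Ky+excess] : b ∣ R * (K * y) + R * excess M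
      b∣R[Ky+excess] = subst (b ∣_) (trans (cong (R *_) Z≡) (*-distribˡ-+ R (K * y) (excess M)))
        (subst (b ∣_) (sym (*-distribˡ-+ R Z (b * K * c))) (∣m∣n⇒∣m+n b∣RZ (∣n⇒∣m*n R b∣bKc)))
      b∣Ky : b ∣ K * y
      b∣Ky = cancel y (subst (b ∣_) (trans (sym (*-assoc R K y)) (cong (_* y) (trans (*-comm R K) (sym L≡KR))))
        (∣m+n∣m⇒∣n (subst (b ∣_) (+-comm (R * (K * y)) (R * excess M)) b∣R[Ky+excess]) (∣n⇒∣m*n R b∣excessM)))

    hit⇒jump : ∀ s → (c + b * s) % L ≡ J (M + D) → Σ ℕ λ z → s ≡ G + R * z
    hit⇒jump s hit with hit⇒offset s hit
    ... | Z , y , bs≡ , Z≡ = quotient , *-cancelˡ-≡ s (G + R * quotient) b (begin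
      b * s                       ≡⟨ bs≡ ⟩
      R * Z + b * G               ≡⟨ cong (λ x → R * x + b * G) (_∣_.equality b∣Z) ⟩
      R * (quotient * b) + b * G  ≡⟨ lemma R quotient b G ⟩
      b * (G + R * quotient)      ∎)
      where
      open ≡-Reasoning
      b∣Z : b ∣ Z
      b∣Z = offset-divisible Z y (∣m+n∣m⇒∣n (subst (b ∣_) (trans bs≡ (+-comm (R * Z) (b * G))) (m∣m*n s)) (m∣m*n G)) Z≡
      quotient = _∣_.quotient b∣Z
      lemma : ∀ R q b G → R * (q * b) + b * G ≡ b * (G + R * q)
      lemma = solve-∀

    classM⇒jump<L : ∀ i → i < K → (c + b * i) % K ≡ J M → G + R * i < L
    classM⇒jump<L i i<K hit = *-cancelˡ-< b (G + R * i) L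
      (≤-<-trans (m≤m+n (b * (G + R * i)) c) (subst (_< b * L) (sym position) bound))
      where
      A = (c + b * i) / K
      c+bi≡ : c + b * i ≡ J M + A * K
      c+bi≡ = trans (m≡m%n+[m/n]*n (c + b * i) K) (cong (_+ A * K) hit)
      A<b : A < b
      A<b = *-cancelʳ-< K A b (+-cancelˡ-< (J M) (A * K) (b * K)
        (subst (_< J M + b * K) c+bi≡ (+-mono-< c<JM (*-monoʳ-< b i<K))))
      position : b * (G + R * i) + c ≡ J (M + D) + A * L
      position = begin
        b * (G + R * i) + c                 ≡⟨ lemma₁ b G R i c ⟩
        (b * G + c) + R * (b * i)           ≡⟨ cong (_+ R * (b * i)) firstJump ⟩
        R * c + J D + R * (b * i)           ≡⟨ lemma₂ R c (J D) (b * i) ⟩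
        R * (c + b * i) + J D               ≡⟨ cong (λ x → R * x + J D) c+bi≡ ⟩
        R * (J M + A * K) + J D             ≡⟨ lemma₃ R (J M) A K (J D) ⟩
        (R * J M + J D) + A * (K * R)       ≡⟨ cong₂ (λ x y → x + A * y) (sym J[M+D]) (sym L≡KR) ⟩
        J (M + D) + A * L                   ∎
        where
        open ≡-Reasoning
        lemma₁ : ∀ b G R i c → b * (G + R * i) + c ≡ (b * G + c) + R * (b * i)
        lemma₁ = solve-∀
        lemma₂ : ∀ R c J x → R * c + J + R * x ≡ R * (c + x) + J
        lemma₂ = solve-∀
        lemma₃ : ∀ R J A K JD → R * (J + A * K) + JD ≡ (R * J + JD) + A * (K * R)
        lemma₃ = solve-∀
      bound : J (M + D) + A * L < b * L
      bound = +-mono-<-≤ (depthPos<r^N j<r (M + D)) (*-monoˡ-≤ L (≤-pred A<b))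

    -- The periodicity properties follow from shift-invariance at depths M + D and M.
    offPeriodic : ∀ q s → (∀ z → s ≢ G + R * z) → u (q * (K * R) + s) ≡ u s
    offPeriodic q s off = trans (cong (λ x → u (q * x + s)) (sym L≡KR))
      (shift-invariant (M + D) q s λ hit → let (z , s≡) = hit⇒jump s hit in off z s≡)

    tailPeriodic : ∀ q i → i < K → K * R ≤ G + R * i → u (q * K + i) ≡ u i
    tailPeriodic q i i<K L≤ = shift-invariant M q i λ hit → <⇒≱ (classM⇒jump<L i i<K hit) (subst (_≤ G + R * i) (sym L≡KR) L≤)

    -- G = 0 would give c = R c + J D > c.
    1≤G : 1 ≤ G
    1≤G with G in G≡
    ... | suc _ = s≤s z≤n
    ... | zero = ⊥-elim (<-irrefl c≡ (subst (suc c ≤_) (+-comm (J D) (R * c)) (+-mono-≤ (≤-trans 1≤D (N≤depthPos 1≤j D)) (m≤n*m c R))))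
      where
      c≡ : c ≡ R * c + J D
      c≡ = trans (cong (_+ c) (sym (trans (cong (b *_) G≡) (*-zeroʳ b)))) firstJump

    -- e ≤ c, since b G + c = R c + J D < R (c + 1); and c < J M < K.
    e<K : e < K
    e<K = ≤-<-trans e≤c (<-trans c<JM (depthPos<r^N j<r M))
      where
      G<R[c+1] : G < R * suc c
      G<R[c+1] = *-cancelˡ-< b G (R * suc c) (≤-<-trans (m≤m+n (b * G) c) (subst (_< b * (R * suc c)) (sym firstJump) (begin-strict
        R * c + J D      <⟨ +-monoʳ-< (R * c) (depthPos<r^N j<r D) ⟩
        R * c + R        ≡⟨ trans (+-comm (R * c) R) (sym (*-suc R c)) ⟩
        R * suc c        ≤⟨ m≤m+n (R * suc c) _ ⟩
        b * (R * suc c)  ∎)))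
        where open ≤-Reasoning
      e≤c : e ≤ c
      e≤c = ≤-pred (*-cancelˡ-< R e (suc c) (≤-<-trans (≤-trans (≤-reflexive (*-comm R e)) (m≤n+m (e * R) ρ)) G<R[c+1]))

    selfSimilar : SelfSimilar u
    selfSimilar = record
      { K = K ; R = R ; ρ = ρ ; e = e ; φ = gapPower f D ; 1≤G = 1≤G ; room = room ; e<K = e<K
      ; jump = jump ; offPeriodic = offPeriodic ; tailPeriodic = tailPeriodic }

  -- excess grows like W (1 + r + … + r^(D-1)), with W = (r - 1) c + j.
  W : ℕ
  W = r₀ * c + j

  -- The test depth: a multiple of the period p beyond M₁ and beyond W.
  N₀ : ℕ
  N₀ = suc (M₁ + W) * p

  instance
    r^N₀≢0 : NonZero (r ^ N₀)
    r^N₀≢0 = m^n≢0 r N₀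

  -- A first jump at depth D with W ≤ r^D leaves room: the digits ρ = G mod r^D, e = G div r^D
  -- satisfy ρ + e < r^D, because (r - 1) b G + W = W r^D by the geometric identity.
  firstJump-room : ∀ D .{{_ : NonZero (r ^ D)}} G → b * G + c ≡ r ^ D * c + J D → W ≤ r ^ D →
    G % r ^ D + G / r ^ D < r ^ D
  firstJump-room D G bG+c≡ W≤R =
    digits-room (r₀ * b) W R (G / R) (G % R) (≤-trans 1≤r₀ (m≤m*n r₀ b)) (≤-trans 1≤j (m≤n+m j (r₀ * c))) scaled (m%n<n G R) W≤R
    where
    R = r ^ D
    1≤r₀ : 1 ≤ r₀
    1≤r₀ = ≤-trans 1≤j (≤-pred j<r)
    scaled : r₀ * b * (G % R + G / R * R) + W ≡ W * R
    scaled = begin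
      r₀ * b * (G % R + G / R * R) + W      ≡⟨ cong (λ x → r₀ * b * x + W) (sym (m≡m%n+[m/n]*n G R)) ⟩
      r₀ * b * G + (r₀ * c + j)             ≡⟨ lemma₁ r₀ b G c j ⟩
      r₀ * (b * G + c) + j                  ≡⟨ cong (λ x → r₀ * x + j) bG+c≡ ⟩
      r₀ * (R * c + J D) + j                ≡⟨ lemma₂ r₀ R c (J D) j ⟩
      r₀ * R * c + (r₀ * J D + j)           ≡⟨ cong (r₀ * R * c +_) (depthPos-geometric r₀ j D) ⟩
      r₀ * R * c + j * R                    ≡⟨ lemma₃ r₀ R c j ⟩
      (r₀ * c + j) * R                      ∎
      where
      open ≡-Reasoning
      lemma₁ : ∀ r₀ b G c j → r₀ * b * G + (r₀ * c + j) ≡ r₀ * (b * G + c) + j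
      lemma₁ = solve-∀
      lemma₂ : ∀ r₀ R c J j → r₀ * (R * c + J) + j ≡ r₀ * R * c + (r₀ * J + j)
      lemma₂ = solve-∀
      lemma₃ : ∀ r₀ R c j → r₀ * R * c + j * R ≡ (r₀ * c + j) * R
      lemma₃ = solve-∀

  -- A term of the progression in the depth-N₀ gap class yields a renormalisation at depth
  -- D = b N₀ (so that b ∣ excess D), with M a multiple of D beyond M₁ and c.
  renormalisation : ∀ s → (c + b * s) % r ^ N₀ ≡ J N₀ → Renormalisation
  renormalisation s hit = record
    { D = D ; M = M ; ρ = G % R ; e = G / R ; 1≤D = 1≤D ; firstJump = firstJump
    ; b∣excessM = excess-* D t₁ b∣excessD
    ; cancel = λ y → cancel-period M D y M₁≤M (b * t₀) (sym (*-assoc b t₀ p))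
    ; c<JM = c<JM ; room = room }
    where
    t₀ t₁ D M R : ℕ
    t₀ = suc (M₁ + W)
    D = b * N₀
    t₁ = suc (M₁ + c)
    M = t₁ * D
    R = r ^ D
    instance
      R≢0 : NonZero R
      R≢0 = m^n≢0 r D
    t₀≤N₀ : t₀ ≤ N₀
    t₀≤N₀ = ≤-trans (≤-reflexive (sym (*-identityʳ t₀))) (*-monoʳ-≤ t₀ 1≤p)
    N₀≤D : N₀ ≤ D
    N₀≤D = m≤n*m N₀ b
    1≤D : 1 ≤ D
    1≤D = ≤-trans (≤-trans (s≤s z≤n) t₀≤N₀) N₀≤D
    t₁≤M : t₁ ≤ M
    t₁≤M = ≤-trans (≤-reflexive (sym (*-identityʳ t₁))) (*-monoʳ-≤ t₁ 1≤D)
    M₁≤M : M₁ ≤ M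
    M₁≤M = ≤-trans (≤-trans (m≤m+n M₁ c) (n≤1+n _)) t₁≤M
    c<JM : c < J M
    c<JM = <-≤-trans (s≤s (m≤n+m c M₁)) (≤-trans t₁≤M (N≤depthPos 1≤j M))
    b∣excessD : b ∣ excess D
    b∣excessD = hit⇒b∣excess t₀ N₀ refl (≤-trans (≤-trans (m≤m+n M₁ W) (n≤1+n _)) t₀≤N₀) s hit
    G = _∣_.quotient b∣excessD
    bG+c≡ : b * G + c ≡ R * c + J D
    bG+c≡ = trans (cong (_+ c) (trans (*-comm b G) (sym (_∣_.equality b∣excessD)))) (excess+c D)
    firstJump : b * (G % R + G / R * R) + c ≡ R * c + J D
    firstJump = trans (cong (λ x → b * x + c) (sym (m≡m%n+[m/n]*n G R))) bG+c≡
    W≤R : W ≤ R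
    W≤R = ≤-trans (≤-trans (≤-trans (m≤n+m W M₁) (n≤1+n _)) (≤-trans t₀≤N₀ N₀≤D))
                  (<⇒≤ (≤-<-trans (N≤depthPos 1≤j D) (depthPos<r^N j<r D)))
    room : G % R + G / R < R
    room = firstJump-room D G bG+c≡ W≤R

  subsequence-toeplitz : ∃ λ (Q : List (Sym k)) → StartsWithLetter Q × IsToeplitzOf Q u
  subsequence-toeplitz with any? (λ (i : Fin (r ^ N₀)) → (c + b * toℕ i) % r ^ N₀ ≟ J N₀)
  ... | yes (i , hit) = selfSimilar⇒toeplitz u (FromRenormalisation.selfSimilar (renormalisation (toℕ i) hit))
  ... | no miss = periodic⇒toeplitz u (r ^ N₀) (misses⇒periodic N₀ λ s s< hit →
    miss (fromℕ< s< , subst (λ x → (c + b * x) % r ^ N₀ ≡ J N₀) (sym (toℕ-fromℕ< s<)) hit))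

-- The subsequence T(P)_{a,b} is the word u of Subsequence for the structure of T(P), b = b₀ + 1
-- and c = a - 1.
mainTheorem2 : (k : ℕ) (P : List (Sym k)) → StartsWithLetter P → gapCount P ≡ 1 →
    (w : Word (Alph k)) → IsToeplitzOf P w →
    (a b : ℕ) → 1 ≤ a → 1 ≤ b →
    ∃ λ (Q : List (Sym k)) → StartsWithLetter Q × IsToeplitzOf Q (arith w a b)
mainTheorem2 k P _ _ w T a zero _ ()
mainTheorem2 k P startsWithLetter oneGap w T a (suc b₀) _ _ =
  Subsequence.subsequence-toeplitz (oneGapToeplitz P startsWithLetter oneGap w T) b₀ (a ∸ 1)
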